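{- Let $\mathbf{D}$ be a D-core algebra and $x,y,z\in D$. Then: (1a) $x\sqcap x=\neg\neg x$, (1b) $x\sqcup x=\lrcorner\lrcorner x$; (2a) $(x\sqcap y)\sqcap(x\sqcap y)=x\sqcap y$, (2b) $(x\sqcup y)\sqcup(x\sqcup y)=x\sqcup y$; (3a) $\neg(x\sqcap(y\vee z))=\neg(x\sqcap y)\sqcap\neg(x\sqcap z)$, (3b) $\lrcorner(x\sqcup(y\wedge z))=\lrcorner(x\sqcup y)\sqcup\lrcorner(x\sqcup z)$; (4a) $x\vee x=x\sqcap x$, (4b) $x\wedge x=x\sqcup x$; (5a) $\neg\neg\neg x=\neg x$, (5b) $\lrcorner\lrcorner\lrcorner x=\lrcorner x$; (6a) $\neg x\sqcap\neg x=\neg x$, (6b) $\lrcorner x\sqcup\lrcorner x=\lrcorner x$.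
   Context: Write $x\vee y:=\neg(\neg x\sqcap\neg y)$ and $x\wedge y:=\lrcorner(\lrcorner x\sqcup\lrcorner y)$. A D-core algebra is an algebra $(D;\sqcap,\sqcup,\neg,\lrcorner,\top,\bot)$ of type $(2,2,1,1,0,0)$ satisfying, for all $x,y,z\in D$: $x\sqcap y=y\sqcap x$; $x\sqcup y=y\sqcup x$; $\neg(x\sqcap x)=\neg x$; $\lrcorner(x\sqcup x)=\lrcorner x$; $x\sqcap(x\sqcup y)=x\sqcap x$; $x\sqcup(x\sqcap y)=x\sqcup x$; $x\sqcap(y\vee z)=(x\sqcap y)\vee(x\sqcap z)$; $x\sqcup(y\wedge z)=(x\sqcup y)\wedge(x\sqcup z)$; $\neg\neg(x\sqcap y)=x\sqcap y$; $\lrcorner\lrcorner(x\sqcup y)=x\sqcup y$; $x\sqcap\neg x=\bot$; $x\sqcup\lrcorner x=\top$; $(x\sqcap x)\sqcup(x\sqcap x)=(x\sqcup x)\sqcap(x\sqcup x)$. -}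

module Defs where

open import Level using (Level; suc)
open import Relation.Binary.PropositionalEquality using (_≡_)

record DCoreAlgebra (a : Level) : Set (suc a) where
  infixr 7 _⊓_
  infixr 6 _⊔_
  field
    Carrier : Set a
    _⊓_ : Carrier → Carrier → Carrier
    _⊔_ : Carrier → Carrier → Carrier
    ¬_  : Carrier → Carrier
    ⌟_  : Carrier → Carrier
    ⊤ : Carrier
    ⊥ : Carrier

  _∨_ : Carrier → Carrier → Carrier
  x ∨ y = ¬ ((¬ x) ⊓ (¬ y))

  _∧_ : Carrier → Carrier → Carrier
  x ∧ y = ⌟ ((⌟ x) ⊔ (⌟ y))

  field
    ⊓-comm : ∀ x y → x ⊓ y ≡ y ⊓ x
    ⊔-comm : ∀ x y → x ⊔ y ≡ y ⊔ x
    ¬-⊓-idem : ∀ x → ¬ (x ⊓ x) ≡ ¬ x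
    ⌟-⊔-idem : ∀ x → ⌟ (x ⊔ x) ≡ ⌟ x
    ⊓-absorb : ∀ x y → x ⊓ (x ⊔ y) ≡ x ⊓ x
    ⊔-absorb : ∀ x y → x ⊔ (x ⊓ y) ≡ x ⊔ x
    ⊓-distrib-∨ : ∀ x y z → x ⊓ (y ∨ z) ≡ (x ⊓ y) ∨ (x ⊓ z)
    ⊔-distrib-∧ : ∀ x y z → x ⊔ (y ∧ z) ≡ (x ⊔ y) ∧ (x ⊔ z)
    ¬¬-⊓ : ∀ x y → ¬ (¬ (x ⊓ y)) ≡ x ⊓ y
    ⌟⌟-⊔ : ∀ x y → ⌟ (⌟ (x ⊔ y)) ≡ x ⊔ y
    ⊓-¬ : ∀ x → x ⊓ (¬ x) ≡ ⊥
    ⊔-⌟ : ∀ x → x ⊔ (⌟ x) ≡ ⊤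
    ⊓⊔-medial : ∀ x → (x ⊓ x) ⊔ (x ⊓ x) ≡ (x ⊔ x) ⊓ (x ⊔ x)

{-# OPTIONS --safe #-}
-- Since ¬¬ fixes every meet and ¬ cannot tell x ⊓ x from x, we get
-- x ⊓ x = ¬¬(x ⊓ x) = ¬¬x; the other ⊓/¬ identities follow from this one,
-- and the ⊔/⌟ identities are the same identities read in the dual algebra.
module Submission where

open import Defs
open import Level using (Level)
open import Data.Product using (_×_; _,_)
open import Relation.Binary.PropositionalEquality using (_≡_; sym; cong; module ≡-Reasoning)

-- Under this duality x ∨ y of the dual is definitionally x ∧ y of the original.
dual : ∀ {a} → DCoreAlgebra a → DCoreAlgebra a
dual D = record
  { Carrier     = Carrier
  ; _⊓_         = _⊔_
  ; _⊔_         = _⊓_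
  ; ¬_          = ⌟_
  ; ⌟_          = ¬_
  ; ⊤           = ⊥
  ; ⊥           = ⊤
  ; ⊓-comm      = ⊔-comm
  ; ⊔-comm      = ⊓-comm
  ; ¬-⊓-idem    = ⌟-⊔-idem
  ; ⌟-⊔-idem    = ¬-⊓-idem
  ; ⊓-absorb    = ⊔-absorb
  ; ⊔-absorb    = ⊓-absorb
  ; ⊓-distrib-∨ = ⊔-distrib-∧
  ; ⊔-distrib-∧ = ⊓-distrib-∨
  ; ¬¬-⊓        = ⌟⌟-⊔
  ; ⌟⌟-⊔        = ¬¬-⊓
  ; ⊓-¬         = ⊔-⌟
  ; ⊔-⌟         = ⊓-¬
  ; ⊓⊔-medial   = λ x → sym (⊓⊔-medial x)
  }
  where open DCoreAlgebra D

module MeetProperties {a : Level} (D : DCoreAlgebra a) where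
  open DCoreAlgebra D
  open ≡-Reasoning

  x⊓x≡¬¬x : ∀ x → x ⊓ x ≡ ¬ (¬ x)
  x⊓x≡¬¬x x = begin
    x ⊓ x             ≡⟨ sym (¬¬-⊓ x x) ⟩
    ¬ (¬ (x ⊓ x))     ≡⟨ cong ¬_ (¬-⊓-idem x) ⟩
    ¬ (¬ x)           ∎

  ⊓-idem-on-⊓ : ∀ x y → (x ⊓ y) ⊓ (x ⊓ y) ≡ x ⊓ y
  ⊓-idem-on-⊓ x y = begin
    (x ⊓ y) ⊓ (x ⊓ y) ≡⟨ x⊓x≡¬¬x (x ⊓ y) ⟩
    ¬ (¬ (x ⊓ y))     ≡⟨ ¬¬-⊓ x y ⟩
    x ⊓ y             ∎

  ¬-distrib-⊓-∨ : ∀ x y z → ¬ (x ⊓ (y ∨ z)) ≡ (¬ (x ⊓ y)) ⊓ (¬ (x ⊓ z))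
  ¬-distrib-⊓-∨ x y z = begin
    ¬ (x ⊓ (y ∨ z))                     ≡⟨ cong ¬_ (⊓-distrib-∨ x y z) ⟩
    ¬ (¬ ((¬ (x ⊓ y)) ⊓ (¬ (x ⊓ z))))   ≡⟨ ¬¬-⊓ (¬ (x ⊓ y)) (¬ (x ⊓ z)) ⟩
    (¬ (x ⊓ y)) ⊓ (¬ (x ⊓ z))           ∎

  ¬¬¬x≡¬x : ∀ x → ¬ (¬ (¬ x)) ≡ ¬ x
  ¬¬¬x≡¬x x = begin
    ¬ (¬ (¬ x))       ≡⟨ cong ¬_ (sym (x⊓x≡¬¬x x)) ⟩
    ¬ (x ⊓ x)         ≡⟨ ¬-⊓-idem x ⟩
    ¬ x               ∎

  ¬x⊓¬x≡¬x : ∀ x → (¬ x) ⊓ (¬ x) ≡ ¬ x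
  ¬x⊓¬x≡¬x x = begin
    (¬ x) ⊓ (¬ x)     ≡⟨ x⊓x≡¬¬x (¬ x) ⟩
    ¬ (¬ (¬ x))       ≡⟨ ¬¬¬x≡¬x x ⟩
    ¬ x               ∎

  x∨x≡x⊓x : ∀ x → x ∨ x ≡ x ⊓ x
  x∨x≡x⊓x x = begin
    ¬ ((¬ x) ⊓ (¬ x)) ≡⟨ cong ¬_ (¬x⊓¬x≡¬x x) ⟩
    ¬ (¬ x)           ≡⟨ sym (x⊓x≡¬¬x x) ⟩
    x ⊓ x             ∎

proposition3p2 : {a : Level} (D : DCoreAlgebra a) → let open DCoreAlgebra D in (x y z : Carrier) → ((x ⊓ x ≡ ¬ (¬ x)) × (x ⊔ x ≡ ⌟ (⌟ x))) × (((x ⊓ y) ⊓ (x ⊓ y) ≡ x ⊓ y) × ((x ⊔ y) ⊔ (x ⊔ y) ≡ x ⊔ y)) × ((¬ (x ⊓ (y ∨ z)) ≡ (¬ (x ⊓ y)) ⊓ (¬ (x ⊓ z))) × (⌟ (x ⊔ (y ∧ z)) ≡ (⌟ (x ⊔ y)) ⊔ (⌟ (x ⊔ z)))) × ((x ∨ x ≡ x ⊓ x) × (x ∧ x ≡ x ⊔ x)) × ((¬ (¬ (¬ x)) ≡ ¬ x) × (⌟ (⌟ (⌟ x)) ≡ ⌟ x)) × (((¬ x) ⊓ (¬ x) ≡ ¬ x) × ((⌟ x) ⊔ (⌟ x) ≡ ⌟ x))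
proposition3p2 D x y z =
    (Meet.x⊓x≡¬¬x x            , Join.x⊓x≡¬¬x x)
  , (Meet.⊓-idem-on-⊓ x y      , Join.⊓-idem-on-⊓ x y)
  , (Meet.¬-distrib-⊓-∨ x y z  , Join.¬-distrib-⊓-∨ x y z)
  , (Meet.x∨x≡x⊓x x            , Join.x∨x≡x⊓x x)
  , (Meet.¬¬¬x≡¬x x            , Join.¬¬¬x≡¬x x)
  , (Meet.¬x⊓¬x≡¬x x           , Join.¬x⊓¬x≡¬x x)
  where
  module Meet = MeetProperties D
  module Join = MeetProperties (dual D)
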